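{- A tournament $T$ is a strong CR tournament if and only if every $1$-transitive blowup of $T$ is a CR tournament.
   Context: A tournament is a digraph with exactly one arc between each pair of distinct vertices. For distinct vertices write $\theta_T(u,v)=1$ if $u\to v$, $-1$ otherwise. Skew-adjacency matrix $S_T$: entry $1$ if $v_i\to v_j$, $-1$ if $v_j\to v_i$, $0$ on the diagonal; $\det(T)=\det(S_T)$. For odd $k\ge1$, $\mathcal{D}_k$ is the set of tournaments all of whose induced subtournaments have determinant at most $k^2$; $\mathcal{D}_{ -1}=\emptyset$. A 1-transitive blowup of $T$ (vertices $v_1,\dots,v_n$) is obtained by replacing one vertex $v_i$ by two vertices $x\to y$, each having the same relation to every $v_j$ ($j\ne i$) as $v_i$ had. A diamond is a 4-tournament consisting of a 3-cycle plus a vertex dominating all of it or dominated by all of it. Two vertices $u_1,u_2$ of $R$ are covertices and revertices if $|V(R)|=2$; if $|V(R)|\ge3$ they are covertices if $\theta_R(u_1,v)=\theta_R(u_2,v)$ for all other $v$, revertices if $\theta_R(u_1,v)=-\theta_R(u_2,v)$ for all other $v$; CR-associated if covertices or revertices. For $u\notin V(R)=\{w_1,\dots,w_m\}$ and $\sigma=(r_1,\dots,r_m)\in\{\pm1\}^m$, $R(u,\sigma)$ extends $R$ by $u$ with $u\to w_i$ iff $r_i=1$; $u$ is a CR vertex for $R$ with $\sigma$ if $u$ is CR-associated in $R(u,\sigma)$ with some vertex of $R$, otherwise a non-CR vertex. Let $R\in\mathcal{D}_k\setminus\mathcal{D}_{k-2}$ for some odd $k$. $R$ is a CR tournament if $R$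 is a 1-tournament, a 2-tournament or a diamond, or else for every $u\notin V(R)$ and every $\sigma$ with $u$ a non-CR vertex for $R$ with $\sigma$, $R(u,\sigma)\notin\mathcal{D}_k$. A strong CR tournament is a CR tournament all of whose 1-transitive blowups are CR tournaments. -}

module Defs where

open import Data.Nat using (ℕ; zero; suc; _+_; _*_)
open import Data.Integer as ℤ using (ℤ; +_; -_)
open import Data.Fin using (Fin; zero; suc; toℕ; punchIn; _≟_)
open import Data.Bool using (Bool; true; false; not; if_then_else_)
open import Data.Product using (Σ; ∃; ∃-syntax; _×_; _,_)
open import Data.Sum using (_⊎_)
open import Data.Empty using (⊥)
open import Relation.Nullary using (¬_; does)
open import Relation.Binary.PropositionalEquality using (_≡_; _≢_)
open import Function.Definitions using (Injective)

-- Tournaments on the vertex set Fin n.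
-- arc i j = true  means  i → j  (for i ≢ j); the diagonal is irrelevant.

record Tournament (n : ℕ) : Set where
  field
    arc  : Fin n → Fin n → Bool
    anti : ∀ i j → i ≢ j → arc i j ≡ not (arc j i)
open Tournament public

-- θ_T(u,v) ∈ {1,-1} encoded as a Bool (true = 1, i.e. u → v)
θ : ∀ {n} → Tournament n → Fin n → Fin n → Bool
θ T = arc T

sumFin : ∀ {n} → (Fin n → ℤ) → ℤ
sumFin {zero}  f = + 0
sumFin {suc n} f = f zero ℤ.+ sumFin (λ j → f (suc j))

altSign : ℕ → ℤ
altSign zero          = + 1
altSign (suc zero)    = - (+ 1)
altSign (suc (suc k)) = altSign k

det : ∀ n → (Fin n → Fin n → ℤ) → ℤ
det zero    M = + 1
det (suc n) M =
  sumFin (λ j → altSign (toℕ j) ℤ.* M zero j ℤ.*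
                 det n (λ a b → M (suc a) (punchIn j b)))

skew : ∀ {n} → Tournament n → Fin n → Fin n → ℤ
skew T i j =
  if does (i ≟ j) then + 0 else (if arc T i j then + 1 else - (+ 1))

detT : ∀ {n} → Tournament n → ℤ
detT {n} T = det n (skew T)

induced : ∀ {m n} → Tournament n → (f : Fin m → Fin n) → Injective _≡_ _≡_ f →
          Tournament m
induced T f inj = record
  { arc  = λ a b → arc T (f a) (f b)
  ; anti = λ a b a≢b → anti T (f a) (f b) (λ e → a≢b (inj e)) }

-- For odd k = 2 m + 1:  T ∈ 𝒟_k  iff every induced subtournament has det ≤ k²
oddNat : ℕ → ℕ
oddNat m = 2 * m + 1

InD : ∀ {n} → ℕ → Tournament n → Set
InD {n} m T =
  ∀ p (f : Fin p → Fin n) (inj : Injective _≡_ _≡_ f) →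
    detT (induced T f inj) ℤ.≤ + (oddNat m * oddNat m)

-- T ∈ 𝒟_{k-2} for k = 2 m + 1, with 𝒟_{-1} = ∅
InDprev : ∀ {n} → ℕ → Tournament n → Set
InDprev zero    T = ⊥
InDprev (suc m) T = InD m T

-- Covertices / revertices / CR-associated (u₁ ≢ u₂; for |V| = 2 the
-- conditions below are vacuous, so both hold, as in the paper)

Covertices : ∀ {n} → Tournament n → Fin n → Fin n → Set
Covertices T u₁ u₂ =
  u₁ ≢ u₂ × (∀ v → v ≢ u₁ → v ≢ u₂ → arc T u₁ v ≡ arc T u₂ v)

Revertices : ∀ {n} → Tournament n → Fin n → Fin n → Set
Revertices T u₁ u₂ =
  u₁ ≢ u₂ × (∀ v → v ≢ u₁ → v ≢ u₂ → arc T u₁ v ≡ not (arc T u₂ v))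

CRAssociated : ∀ {n} → Tournament n → Fin n → Fin n → Set
CRAssociated T u₁ u₂ = Covertices T u₁ u₂ ⊎ Revertices T u₁ u₂

-- R(u,σ): the new vertex u is `zero`, old vertex w_j is `suc j`;
-- σ j = true  iff  u → w_j

extend : ∀ {m} → Tournament m → (Fin m → Bool) → Tournament (suc m)
extend {m} R σ = record { arc = a ; anti = an }
  where
  a : Fin (suc m) → Fin (suc m) → Bool
  a zero    zero    = false
  a zero    (suc j) = σ j
  a (suc i) zero    = not (σ i)
  a (suc i) (suc j) = arc R i j
  an : ∀ i j → i ≢ j → a i j ≡ not (a j i)
  an zero    zero    ne = Data.Empty.⊥-elim (ne Relation.Binary.PropositionalEquality.refl)
  an zero    (suc j) ne with σ j
  ... | true  = Relation.Binary.PropositionalEquality.refl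
  ... | false = Relation.Binary.PropositionalEquality.refl
  an (suc i) zero    ne = Relation.Binary.PropositionalEquality.refl
  an (suc i) (suc j) ne =
    anti R i j (λ e → ne (Relation.Binary.PropositionalEquality.cong suc e))

CRVertex : ∀ {m} → Tournament m → (Fin m → Bool) → Set
CRVertex R σ = ∃[ j ] CRAssociated (extend R σ) zero (suc j)

NonCRVertex : ∀ {m} → Tournament m → (Fin m → Bool) → Set
NonCRVertex R σ = ¬ CRVertex R σ

IsDiamond : ∀ {n} → Tournament n → Set
IsDiamond {n} T =
  n ≡ 4 ×
  ∃[ v ] (((∀ w → w ≢ v → arc T v w ≡ true) ⊎ (∀ w → w ≢ v → arc T w v ≡ true)) ×
          ∃[ a ] ∃[ b ] ∃[ c ] (a ≢ v × b ≢ v × c ≢ v × a ≢ b × b ≢ c × a ≢ c ×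
             arc T a b ≡ true × arc T b c ≡ true × arc T c a ≡ true))

CR : ∀ {n} → Tournament n → Set
CR {n} R =
  ∃[ m ] (InD m R × ¬ InDprev m R ×
    (n ≡ 1 ⊎ n ≡ 2 ⊎ IsDiamond R ⊎
     (∀ (σ : Fin n → Bool) → NonCRVertex R σ → ¬ InD m (extend R σ))))

-- 1-transitive blowup at vertex i of T on Fin n.
-- New vertex `zero` is x, vertex `suc i` is y (x → y), and `suc j` is v_j.

blowup : ∀ {n} → Tournament n → Fin n → Tournament (suc n)
blowup {n} T i = extend T σ
  where
  σ : Fin n → Bool
  σ j = if does (j ≟ i) then true else arc T i j

StrongCR : ∀ {n} → Tournament n → Set
StrongCR {n} T = CR T × (∀ i → CR (blowup T i))

{-# OPTIONS --safe #-}
-- It suffices to show that T is CR when its blowup T′ at vertex 0 is. In T′ the two copies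
-- x → y of vertex 0 are covertices, and deleting x gives back T.
--
-- If x → y are covertices of a tournament, the row of x in the skew matrix is the row of y plus
-- the unit vectors at x and y, while the columns of x and y agree off {x , y}; expanding the
-- determinant along these rows shows that deleting x and y does not change it. Hence every
-- induced subtournament of T′ has the determinant of one of T, so T′ lies in exactly the same
-- classes 𝒟_k as T. The same holds for T(u, σ) and T′(u, σ′) when σ′ treats x as σ treats
-- vertex 0, and u is then a CR vertex of T′ only if it is one of T. Finally a diamond has no
-- covertices, so T′ is not a diamond.
module Submission where

open import Defs
open import Data.Bool using (Bool; true; false; not; if_then_else_)
open import Data.Empty using (⊥-elim)
open import Data.Fin using (Fin; zero; suc; toℕ; punchIn; punchOut; inject₁; _≟_)
open import Data.Fin.Induction using (<-weakInduction)
open import Data.Fin.Properties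
  using (injective⇒≤; suc-injective; punchIn-injective; punchInᵢ≢i; punchIn-punchOut; any?)
open import Data.Integer as ℤ using (ℤ; +_; -[1+_]; -_; _+_; _*_; 0ℤ; 1ℤ; -1ℤ)
import Data.Integer.Properties as ℤP
open import Algebra.Properties.CommutativeSemigroup ℤP.+-commutativeSemigroup
  using (interchange; x∙yz≈y∙xz)
open import Data.Integer.Tactic.RingSolver using (solve-∀)
open import Data.Nat as ℕ using (ℕ; zero; suc)
import Data.Nat.Properties as ℕP
open import Data.Product using (∃-syntax; _×_; _,_; proj₁; proj₂)
open import Data.Sum as Sum using (_⊎_; inj₁; inj₂)
open import Data.Vec using (Vec; []; _∷_)
import Data.Vec.Functional as Vector
import Data.Vec.Membership.DecPropositional as DecMembership
open import Data.Vec.Membership.Propositional using (_∈_)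
open import Data.Vec.Membership.Propositional.Properties using (∈-lookup)
open import Data.Vec.Relation.Unary.All using (All; []; _∷_)
open import Data.Vec.Relation.Unary.All.Properties using (lookup⁻)
open import Data.Vec.Relation.Unary.AllPairs using ([]; _∷_)
open import Data.Vec.Relation.Unary.Any using (here; there)
open import Data.Vec.Relation.Unary.Unique.Propositional using (Unique)
open import Data.Vec.Relation.Unary.Unique.Propositional.Properties using (lookup-injective)
open import Function using (_∘_; id)
open import Function.Bundles using (_⇔_; mk⇔)
open import Function.Definitions using (Injective)
open import Relation.Binary.PropositionalEquality
open import Relation.Nullary using (¬_; does; yes; no)
open import Relation.Nullary.Decidable using (dec-true; dec-false)

-- Finite sums and determinants

Matrix : ℕ → Set
Matrix n = Fin n → Fin n → ℤ

sign : ∀ {n} → Fin n → ℤ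
sign j = altSign (toℕ j)

sign-suc : ∀ {n} (j : Fin n) → sign (suc j) ≡ - sign j
sign-suc j = altSign-suc (toℕ j)
  where
  altSign-suc : ∀ k → altSign (suc k) ≡ - altSign k
  altSign-suc zero          = refl
  altSign-suc (suc zero)    = refl
  altSign-suc (suc (suc k)) = altSign-suc k

sumFin-cong : ∀ {n} {f g : Fin n → ℤ} → (∀ j → f j ≡ g j) → sumFin f ≡ sumFin g
sumFin-cong {zero}  f≗g = refl
sumFin-cong {suc n} f≗g = cong₂ _+_ (f≗g zero) (sumFin-cong (f≗g ∘ suc))

sumFin-zero : ∀ n → sumFin {n} (λ _ → 0ℤ) ≡ 0ℤ
sumFin-zero zero    = refl
sumFin-zero (suc n) = cong (_+_ 0ℤ) (sumFin-zero n)

sumFin-distrib-+ : ∀ {n} (f g : Fin n → ℤ) →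
  sumFin (λ j → f j + g j) ≡ sumFin f + sumFin g
sumFin-distrib-+ {zero}  f g = refl
sumFin-distrib-+ {suc n} f g =
  trans (cong (_+_ (f zero + g zero)) (sumFin-distrib-+ (f ∘ suc) (g ∘ suc)))
        (interchange (f zero) (g zero) (sumFin (f ∘ suc)) (sumFin (g ∘ suc)))

*-distribˡ-sumFin : ∀ {n} (c : ℤ) (f : Fin n → ℤ) → c * sumFin f ≡ sumFin (λ j → c * f j)
*-distribˡ-sumFin {zero}  c f = ℤP.*-zeroʳ c
*-distribˡ-sumFin {suc n} c f =
  trans (ℤP.*-distribˡ-+ c (f zero) (sumFin (f ∘ suc)))
        (cong (_+_ (c * f zero)) (*-distribˡ-sumFin c (f ∘ suc)))

neg-distrib-sumFin : ∀ {n} (f : Fin n → ℤ) → - sumFin f ≡ sumFin (λ j → - f j)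
neg-distrib-sumFin {zero}  f = refl
neg-distrib-sumFin {suc n} f =
  trans (ℤP.neg-distrib-+ (f zero) (sumFin (f ∘ suc)))
        (cong (_+_ (- f zero)) (neg-distrib-sumFin (f ∘ suc)))

minor : ∀ {n} → Matrix (suc n) → Fin (suc n) → Matrix n
minor M j a b = M (suc a) (punchIn j b)

laplaceTerm : ∀ {n} → Matrix (suc n) → Fin (suc n) → ℤ
laplaceTerm {n} M j = sign j * M zero j * det n (minor M j)

det-cong : ∀ n {M N : Matrix n} → (∀ a b → M a b ≡ N a b) → det n M ≡ det n N
det-cong zero    M≗N = refl
det-cong (suc n) M≗N = sumFin-cong λ j →
  cong₂ (λ x y → sign j * x * y) (M≗N zero j) (det-cong n λ a b → M≗N (suc a) (punchIn j b))

swapAdj : ∀ {n} → Fin n → Fin (suc n) → Fin (suc n)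
swapAdj zero    zero          = suc zero
swapAdj zero    (suc zero)    = zero
swapAdj zero    (suc (suc a)) = suc (suc a)
swapAdj (suc k) zero          = zero
swapAdj (suc k) (suc a)       = suc (swapAdj k a)

sumFin-swapAdj : ∀ {n} (k : Fin n) (f : Fin (suc n) → ℤ) → sumFin (f ∘ swapAdj k) ≡ sumFin f
sumFin-swapAdj zero    f = x∙yz≈y∙xz (f (suc zero)) (f zero) _
sumFin-swapAdj (suc k) f = cong (_+_ (f zero)) (sumFin-swapAdj k (f ∘ suc))

-- Determinants under adjacent transpositions

-- (punchIn j l , punchBack j l) lists the pair of columns {j , punchIn j l} of a two-row
-- expansion in the other order.
punchBack : ∀ {n} → Fin (suc n) → Fin n → Fin n
punchBack {suc n} zero    l       = zero
punchBack         (suc j) zero    = j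
punchBack         (suc j) (suc l) = suc (punchBack j l)

punchIn-punchBack : ∀ {n} (j : Fin (suc n)) (l : Fin n) → punchIn (punchIn j l) (punchBack j l) ≡ j
punchIn-punchBack {suc n} zero    l       = refl
punchIn-punchBack         (suc j) zero    = refl
punchIn-punchBack         (suc j) (suc l) = cong suc (punchIn-punchBack j l)

punchIn-punchIn-punchBack : ∀ {n} (j : Fin (suc (suc n))) (l : Fin (suc n)) (b : Fin n) →
  punchIn j (punchIn l b) ≡ punchIn (punchIn j l) (punchIn (punchBack j l) b)
punchIn-punchIn-punchBack zero    l       b       = refl
punchIn-punchIn-punchBack (suc j) zero    b       = refl
punchIn-punchIn-punchBack (suc j) (suc l) zero    = refl
punchIn-punchIn-punchBack (suc j) (suc l) (suc b) = cong suc (punchIn-punchIn-punchBack j l b)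

sign-punchBack : ∀ {n} (j : Fin (suc n)) (l : Fin n) →
  sign (punchIn j l) * sign (punchBack j l) ≡ - (sign j * sign l)
sign-punchBack {suc n} zero    l       rewrite sign-suc l =
  trans (ℤP.*-identityʳ (- sign l)) (cong -_ (sym (ℤP.*-identityˡ (sign l))))
sign-punchBack         (suc j) zero    rewrite sign-suc j =
  trans (ℤP.*-identityˡ (sign j))
        (sym (trans (cong -_ (ℤP.*-identityʳ (- sign j))) (ℤP.neg-involutive (sign j))))
sign-punchBack         (suc j) (suc l)
  rewrite sign-suc (punchIn j l) | sign-suc (punchBack j l) | sign-suc j | sign-suc l =
  trans (neg*neg (sign (punchIn j l)) (sign (punchBack j l)))
        (trans (sign-punchBack j l) (cong -_ (sym (neg*neg (sign j) (sign l)))))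
  where
  neg*neg : ∀ s t → - s * - t ≡ s * t
  neg*neg = solve-∀

sumFin-punchBack : ∀ {n} (H : Fin (suc n) → Fin n → ℤ) →
  sumFin (λ j → sumFin (H j)) ≡ sumFin (λ j → sumFin (λ l → H (punchIn j l) (punchBack j l)))
sumFin-punchBack {zero}  H = refl
sumFin-punchBack {suc n} H = begin
  sumFin (H zero) + sumFin (λ j → column₀ j + sumFin (H (suc j) ∘ suc))
    ≡⟨ cong (_+_ (sumFin (H zero))) (sumFin-distrib-+ column₀ (λ j → sumFin (H (suc j) ∘ suc))) ⟩
  sumFin (H zero) + (sumFin column₀ + sumFin (λ j → sumFin (H (suc j) ∘ suc)))
    ≡⟨ cong (λ x → sumFin (H zero) + (sumFin column₀ + x)) (sumFin-punchBack (λ j l → H (suc j) (suc l))) ⟩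
  sumFin (H zero) + (sumFin column₀ + sumFin flippedRest)
    ≡⟨ x∙yz≈y∙xz (sumFin (H zero)) (sumFin column₀) (sumFin flippedRest) ⟩
  sumFin column₀ + (sumFin (H zero) + sumFin flippedRest)
    ≡⟨ cong (_+_ (sumFin column₀)) (sym (sumFin-distrib-+ (H zero) flippedRest)) ⟩
  sumFin column₀ + sumFin (λ j → H zero j + flippedRest j)
    ∎
  where
  open ≡-Reasoning
  column₀ : Fin (suc n) → ℤ
  column₀ j = H (suc j) zero
  flippedRest : Fin (suc n) → ℤ
  flippedRest j = sumFin (λ l → H (suc (punchIn j l)) (suc (punchBack j l)))

expansionTerm₂ : ∀ n → Matrix (suc (suc n)) → Fin (suc (suc n)) → Fin (suc n) → ℤ
expansionTerm₂ n M j l = sign j * M zero j * laplaceTerm (minor M j) l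

det-expand₂ : ∀ n (M : Matrix (suc (suc n))) →
  det (suc (suc n)) M ≡ sumFin (λ j → sumFin (expansionTerm₂ n M j))
det-expand₂ n M = sumFin-cong λ j → *-distribˡ-sumFin (sign j * M zero j) (laplaceTerm (minor M j))

det-swapRows01 : ∀ n (M : Matrix (suc (suc n))) →
  det (suc (suc n)) (M ∘ swapAdj zero) ≡ - det (suc (suc n)) M
det-swapRows01 n M = begin
  det (suc (suc n)) (M ∘ swapAdj zero)
    ≡⟨ det-expand₂ n (M ∘ swapAdj zero) ⟩
  sumFin (λ j → sumFin (expansionTerm₂ n (M ∘ swapAdj zero) j))
    ≡⟨ sumFin-punchBack (expansionTerm₂ n (M ∘ swapAdj zero)) ⟩
  sumFin (λ j → sumFin (λ l → expansionTerm₂ n (M ∘ swapAdj zero) (punchIn j l) (punchBack j l)))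
    ≡⟨ sumFin-cong (λ j → sumFin-cong (flipped j)) ⟩
  sumFin (λ j → sumFin (λ l → - expansionTerm₂ n M j l))
    ≡⟨ sumFin-cong (λ j → sym (neg-distrib-sumFin (expansionTerm₂ n M j))) ⟩
  sumFin (λ j → - sumFin (expansionTerm₂ n M j))
    ≡⟨ sym (neg-distrib-sumFin (λ j → sumFin (expansionTerm₂ n M j))) ⟩
  - sumFin (λ j → sumFin (expansionTerm₂ n M j))
    ≡⟨ cong -_ (sym (det-expand₂ n M)) ⟩
  - det (suc (suc n)) M
    ∎
  where
  open ≡-Reasoning
  rearrange : ∀ s t u v x y z → s * t ≡ - (u * v) → s * x * (t * y * z) ≡ - (u * y * (v * x * z))
  rearrange s t u v x y z st≡-uv = trans (lhs s t x y z) (trans (cong (_* (x * y * z)) st≡-uv) (rhs u v x y z))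
    where
    lhs : ∀ s t x y z → s * x * (t * y * z) ≡ s * t * (x * y * z)
    lhs = solve-∀
    rhs : ∀ u v x y z → - (u * v) * (x * y * z) ≡ - (u * y * (v * x * z))
    rhs = solve-∀
  flipped : ∀ j l →
    expansionTerm₂ n (M ∘ swapAdj zero) (punchIn j l) (punchBack j l) ≡ - expansionTerm₂ n M j l
  flipped j l = trans
    (cong₂ (λ c d → sign (punchIn j l) * M (suc zero) (punchIn j l) * (sign (punchBack j l) * M zero c * d))
      (punchIn-punchBack j l)
      (det-cong n (λ a b → cong (M (suc (suc a))) (sym (punchIn-punchIn-punchBack j l b)))))
    (rearrange (sign (punchIn j l)) (sign (punchBack j l)) (sign j) (sign l)
       (M (suc zero) (punchIn j l)) (M zero j) (det n (λ a b → M (suc (suc a)) (punchIn j (punchIn l b))))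
       (sign-punchBack j l))

det-swapRows : ∀ n (k : Fin n) (M : Matrix (suc n)) → det (suc n) (M ∘ swapAdj k) ≡ - det (suc n) M
det-swapRows (suc n) zero    M = det-swapRows01 n M
det-swapRows (suc n) (suc k) M =
  trans (sumFin-cong λ j →
          trans (cong (sign j * M zero j *_) (det-swapRows n k (minor M j)))
                (sym (ℤP.neg-distribʳ-* (sign j * M zero j) (det (suc n) (minor M j)))))
        (sym (neg-distrib-sumFin (laplaceTerm M)))

-- Either j is one of the swapped columns k, k + 1, or both survive in the minor at j,
-- where they are again adjacent.
swapAdj-punchIn : ∀ {m} (k : Fin (suc m)) (j : Fin (suc (suc m))) →
  (sign (swapAdj k j) ≡ - sign j × (∀ b → swapAdj k (punchIn j b) ≡ punchIn (swapAdj k j) b))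
  ⊎ (swapAdj k j ≡ j × ∃[ k′ ] (∀ b → swapAdj k (punchIn j b) ≡ punchIn j (swapAdj k′ b)))
swapAdj-punchIn zero zero = inj₁ (refl , λ { zero → refl ; (suc b) → refl })
swapAdj-punchIn zero (suc zero) = inj₁ (refl , λ { zero → refl ; (suc b) → refl })
swapAdj-punchIn {suc m} zero (suc (suc j)) =
  inj₂ (refl , zero , λ { zero → refl ; (suc zero) → refl ; (suc (suc b)) → refl })
swapAdj-punchIn {suc m} (suc k) zero = inj₂ (refl , k , λ b → refl)
swapAdj-punchIn {suc m} (suc k) (suc j) with swapAdj-punchIn k j
... | inj₁ (sign≡ , commute) =
  inj₁ ( trans (sign-suc (swapAdj k j)) (trans (cong -_ sign≡) (cong -_ (sym (sign-suc j))))
       , λ { zero → refl ; (suc b) → cong suc (commute b) })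
... | inj₂ (fixed , k′ , commute) =
  inj₂ (cong suc fixed , suc k′ , λ { zero → refl ; (suc b) → cong suc (commute b) })

det-swapCols : ∀ n (k : Fin n) (M : Matrix (suc n)) → det (suc n) (λ r → M r ∘ swapAdj k) ≡ - det (suc n) M
det-swapCols (suc m) k M =
  trans (sumFin-cong term) (trans (sym (neg-distrib-sumFin (F ∘ swapAdj k))) (cong -_ (sumFin-swapAdj k F)))
  where
  open ≡-Reasoning
  F : Fin (suc (suc m)) → ℤ
  F = laplaceTerm M
  term : ∀ j → sign j * M zero (swapAdj k j) * det (suc m) (λ a b → M (suc a) (swapAdj k (punchIn j b)))
               ≡ - F (swapAdj k j)
  term j with swapAdj-punchIn k j
  ... | inj₁ (sign≡ , commute) = begin
    sign j * M zero (swapAdj k j) * det (suc m) (λ a b → M (suc a) (swapAdj k (punchIn j b)))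
      ≡⟨ cong₂ (λ s d → s * M zero (swapAdj k j) * d)
           (trans (sym (ℤP.neg-involutive (sign j))) (cong -_ (sym sign≡)))
           (det-cong (suc m) λ a b → cong (M (suc a)) (commute b)) ⟩
    - sign (swapAdj k j) * M zero (swapAdj k j) * det (suc m) (minor M (swapAdj k j))
      ≡⟨ cong (_* det (suc m) (minor M (swapAdj k j)))
           (sym (ℤP.neg-distribˡ-* (sign (swapAdj k j)) (M zero (swapAdj k j)))) ⟩
    - (sign (swapAdj k j) * M zero (swapAdj k j)) * det (suc m) (minor M (swapAdj k j))
      ≡⟨ sym (ℤP.neg-distribˡ-* (sign (swapAdj k j) * M zero (swapAdj k j))
                                 (det (suc m) (minor M (swapAdj k j)))) ⟩
    - F (swapAdj k j)
      ∎
  ... | inj₂ (fixed , k′ , commute) rewrite fixed = begin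
    sign j * M zero j * det (suc m) (λ a b → M (suc a) (swapAdj k (punchIn j b)))
      ≡⟨ cong (sign j * M zero j *_)
           (trans (det-cong (suc m) λ a b → cong (M (suc a)) (commute b)) (det-swapCols m k′ (minor M j))) ⟩
    sign j * M zero j * - det (suc m) (minor M j)
      ≡⟨ sym (ℤP.neg-distribʳ-* (sign j * M zero j) (det (suc m) (minor M j))) ⟩
    - F j
      ∎

det-conj-swapAdj : ∀ n (k : Fin n) (M : Matrix (suc n)) →
  det (suc n) (λ r c → M (swapAdj k r) (swapAdj k c)) ≡ det (suc n) M
det-conj-swapAdj n k M =
  trans (det-swapRows n k (λ r → M r ∘ swapAdj k))
        (trans (cong -_ (det-swapCols n k M)) (ℤP.neg-involutive _))

moveToFront : ∀ {n} → Fin (suc n) → Fin (suc n) → Fin (suc n)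
moveToFront s zero    = s
moveToFront s (suc a) = punchIn s a

moveToFront-injective : ∀ {n} (s : Fin (suc n)) {x y} → moveToFront s x ≡ moveToFront s y → x ≡ y
moveToFront-injective s {zero}  {zero}  _ = refl
moveToFront-injective s {zero}  {suc b} e = ⊥-elim (punchInᵢ≢i s b (sym e))
moveToFront-injective s {suc a} {zero}  e = ⊥-elim (punchInᵢ≢i s a e)
moveToFront-injective s {suc a} {suc b} e = cong suc (punchIn-injective s a b e)

moveToFront-suc : ∀ {n} (s : Fin n) (x : Fin (suc n)) →
  swapAdj s (moveToFront (inject₁ s) x) ≡ moveToFront (suc s) x
moveToFront-suc zero    zero          = refl
moveToFront-suc zero    (suc zero)    = refl
moveToFront-suc zero    (suc (suc a)) = refl
moveToFront-suc (suc s) zero          = cong suc (moveToFront-suc s zero)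
moveToFront-suc (suc s) (suc zero)    = refl
moveToFront-suc (suc s) (suc (suc a)) = cong suc (moveToFront-suc s (suc a))

det-conj-moveToFront : ∀ n (s : Fin (suc n)) (M : Matrix (suc n)) →
  det (suc n) (λ r c → M (moveToFront s r) (moveToFront s c)) ≡ det (suc n) M
det-conj-moveToFront n = <-weakInduction Invariant base step
  where
  Invariant : Fin (suc n) → Set
  Invariant s = ∀ M → det (suc n) (λ r c → M (moveToFront s r) (moveToFront s c)) ≡ det (suc n) M
  moveToFront-zero : ∀ x → moveToFront zero x ≡ x
  moveToFront-zero zero    = refl
  moveToFront-zero (suc a) = refl
  base : Invariant zero
  base M = det-cong (suc n) λ r c → cong₂ M (moveToFront-zero r) (moveToFront-zero c)
  step : ∀ s → Invariant (inject₁ s) → Invariant (suc s)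
  step s inv M = begin
    det (suc n) (λ r c → M (moveToFront (suc s) r) (moveToFront (suc s) c))
      ≡⟨ det-cong (suc n) (λ r c → sym (cong₂ M (moveToFront-suc s r) (moveToFront-suc s c))) ⟩
    det (suc n) (λ r c → M (swapAdj s (moveToFront (inject₁ s) r)) (swapAdj s (moveToFront (inject₁ s) c)))
      ≡⟨ inv (λ r c → M (swapAdj s r) (swapAdj s c)) ⟩
    det (suc n) (λ r c → M (swapAdj s r) (swapAdj s c))
      ≡⟨ det-conj-swapAdj n s M ⟩
    det (suc n) M
      ∎
    where open ≡-Reasoning

det-equalFirstRows : ∀ n (M : Matrix (suc (suc n))) → (∀ c → M zero c ≡ M (suc zero) c) →
  det (suc (suc n)) M ≡ 0ℤ
det-equalFirstRows n M rows≡ =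
  x≡-x⇒x≡0 _ (trans (det-cong (suc (suc n)) swapped≗M) (det-swapRows01 n M))
  where
  swapped≗M : ∀ r c → M r c ≡ M (swapAdj zero r) c
  swapped≗M zero          c = rows≡ c
  swapped≗M (suc zero)    c = sym (rows≡ c)
  swapped≗M (suc (suc r)) c = refl
  x≡-x⇒x≡0 : ∀ x → x ≡ - x → x ≡ 0ℤ
  x≡-x⇒x≡0 (+ zero)  _  = refl
  x≡-x⇒x≡0 (+ suc _) ()
  x≡-x⇒x≡0 -[1+ _ ]  ()

-- The two minors agree except at (0 , 0), where they have -1 and 0.
det-minor₁ : ∀ q (M : Matrix (suc (suc q))) →
  M (suc zero) zero ≡ -1ℤ → M (suc zero) (suc zero) ≡ 0ℤ →
  (∀ r → M (suc (suc r)) zero ≡ M (suc (suc r)) (suc zero)) →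
  det (suc q) (minor M (suc zero)) ≡
    det (suc q) (minor M zero) + - det q (λ a b → M (suc (suc a)) (suc (suc b)))
det-minor₁ q M m10 m11 cols≡ = begin
  det (suc q) (minor M (suc zero))
    ≡⟨ sumFin-cong firstEntry ⟩
  sumFin (λ l → laplaceTerm (minor M zero) l + h l)
    ≡⟨ sumFin-distrib-+ (laplaceTerm (minor M zero)) h ⟩
  det (suc q) (minor M zero) + (- N + sumFin {q} (λ _ → 0ℤ))
    ≡⟨ cong (λ x → det (suc q) (minor M zero) + (- N + x)) (sumFin-zero q) ⟩
  det (suc q) (minor M zero) + (- N + 0ℤ)
    ≡⟨ cong (_+_ (det (suc q) (minor M zero))) (ℤP.+-identityʳ (- N)) ⟩
  det (suc q) (minor M zero) + - N
    ∎
  where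
  open ≡-Reasoning
  N : ℤ
  N = det q (λ a b → M (suc (suc a)) (suc (suc b)))
  h : Fin (suc q) → ℤ
  h zero    = - N
  h (suc _) = 0ℤ
  column1≗column0 : ∀ a y → M (suc (suc a)) (punchIn (suc zero) y) ≡ M (suc (suc a)) (suc y)
  column1≗column0 a zero    = cols≡ a
  column1≗column0 a (suc y) = refl
  firstEntry : ∀ l → laplaceTerm (minor M (suc zero)) l ≡ laplaceTerm (minor M zero) l + h l
  firstEntry zero rewrite m10 | m11 = lemma N
    where
    lemma : ∀ d → 1ℤ * -1ℤ * d ≡ 1ℤ * 0ℤ * d + - d
    lemma = solve-∀
  firstEntry (suc l) =
    trans (cong (sign (suc l) * M (suc zero) (suc (suc l)) *_)
                (det-cong q λ a b → column1≗column0 a (punchIn (suc l) b)))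
          (sym (ℤP.+-identityʳ _))

det-covertexBlock : ∀ q (M : Matrix (suc (suc q))) →
  M zero zero ≡ 0ℤ → M zero (suc zero) ≡ 1ℤ → M (suc zero) zero ≡ -1ℤ → M (suc zero) (suc zero) ≡ 0ℤ →
  (∀ c → M zero (suc (suc c)) ≡ M (suc zero) (suc (suc c))) →
  (∀ r → M (suc (suc r)) zero ≡ M (suc (suc r)) (suc zero)) →
  det (suc (suc q)) M ≡ det q (λ a b → M (suc (suc a)) (suc (suc b)))
det-covertexBlock q M m00 m01 m10 m11 rows≡ cols≡ = begin
  det (suc (suc q)) M
    ≡⟨ sumFin-cong firstRow ⟩
  sumFin (λ j → laplaceTerm M₁ j + e j)
    ≡⟨ sumFin-distrib-+ (laplaceTerm M₁) e ⟩
  det (suc (suc q)) M₁ + (D zero + (- D (suc zero) + sumFin {q} (λ _ → 0ℤ)))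
    ≡⟨ cong₂ (λ x y → x + (D zero + (- D (suc zero) + y)))
         (det-equalFirstRows q M₁ (λ _ → refl)) (sumFin-zero q) ⟩
  0ℤ + (D zero + (- D (suc zero) + 0ℤ))
    ≡⟨ cong (λ x → 0ℤ + (D zero + (- x + 0ℤ))) (det-minor₁ q M m10 m11 cols≡) ⟩
  0ℤ + (D zero + (- (D zero + - N) + 0ℤ))
    ≡⟨ cancel (D zero) N ⟩
  N ∎
  where
  open ≡-Reasoning
  N : ℤ
  N = det q (λ a b → M (suc (suc a)) (suc (suc b)))
  D : Fin (suc (suc q)) → ℤ
  D j = det (suc q) (minor M j)
  M₁ : Matrix (suc (suc q))
  M₁ zero    = M (suc zero)
  M₁ (suc r) = M (suc r)
  -- row 0 of M is row 1 plus the unit vectors at columns 0 and 1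
  e : Fin (suc (suc q)) → ℤ
  e zero          = D zero
  e (suc zero)    = - D (suc zero)
  e (suc (suc _)) = 0ℤ
  firstRow : ∀ j → laplaceTerm M j ≡ laplaceTerm M₁ j + e j
  firstRow zero rewrite m00 | m10 = lemma (D zero)
    where
    lemma : ∀ d → 1ℤ * 0ℤ * d ≡ 1ℤ * -1ℤ * d + d
    lemma = solve-∀
  firstRow (suc zero) rewrite m01 | m11 = lemma (D (suc zero))
    where
    lemma : ∀ d → -1ℤ * 1ℤ * d ≡ -1ℤ * 0ℤ * d + - d
    lemma = solve-∀
  firstRow (suc (suc c)) rewrite rows≡ c = sym (ℤP.+-identityʳ _)
  cancel : ∀ d n → 0ℤ + (d + (- (d + - n) + 0ℤ)) ≡ n
  cancel = solve-∀

-- Skew matrices of subtournaments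

sgn : Bool → ℤ
sgn b = if b then 1ℤ else -1ℤ

skewOf : ∀ {p} → (Fin p → Fin p → Bool) → Matrix p
skewOf A x y = if does (x ≟ y) then 0ℤ else sgn (A x y)

skewOf-cong : ∀ {p} {A B : Fin p → Fin p → Bool} → (∀ x y → x ≢ y → A x y ≡ B x y) →
  ∀ x y → skewOf A x y ≡ skewOf B x y
skewOf-cong A≗B x y with x ≟ y
... | yes _   = refl
... | no  x≢y = cong sgn (A≗B x y x≢y)

skewOf-reindex : ∀ {p q} (A : Fin p → Fin p → Bool) {π : Fin q → Fin p} → Injective _≡_ _≡_ π →
  ∀ x y → skewOf A (π x) (π y) ≡ skewOf (λ x y → A (π x) (π y)) x y
skewOf-reindex A {π} π-inj x y with π x ≟ π y | x ≟ y
... | yes _     | yes _   = refl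
... | no  _     | no  _   = refl
... | yes πx≡πy | no  x≢y = ⊥-elim (x≢y (π-inj πx≡πy))
... | no  πx≢πy | yes x≡y = ⊥-elim (πx≢πy (cong π x≡y))

detAlong : ∀ {n p} → Tournament n → (Fin p → Fin n) → ℤ
detAlong {p = p} R f = det p (skewOf (λ x y → arc R (f x) (f y)))

detAlong-cong : ∀ {n n′ p} (R : Tournament n) (S : Tournament n′) (f : Fin p → Fin n) (g : Fin p → Fin n′) →
  (∀ x y → x ≢ y → arc R (f x) (f y) ≡ arc S (g x) (g y)) → detAlong R f ≡ detAlong S g
detAlong-cong {p = p} R S f g arcs≡ = det-cong p (skewOf-cong arcs≡)

detAlong-moveToFront : ∀ {n p} (R : Tournament n) (f : Fin (suc p) → Fin n) (s : Fin (suc p)) →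
  detAlong R (f ∘ moveToFront s) ≡ detAlong R f
detAlong-moveToFront {p = p} R f s =
  trans (sym (det-cong (suc p) (skewOf-reindex (λ x y → arc R (f x) (f y)) (moveToFront-injective s))))
        (det-conj-moveToFront p s (skewOf (λ x y → arc R (f x) (f y))))

anti-true : ∀ {n} (T : Tournament n) {u v} → u ≢ v → arc T u v ≡ true → arc T v u ≡ false
anti-true T {u} {v} u≢v u→v = trans (anti T v u (u≢v ∘ sym)) (cong not u→v)

covertices-sym : ∀ {n} (T : Tournament n) {u₁ u₂} → Covertices T u₁ u₂ → Covertices T u₂ u₁
covertices-sym T (u₁≢u₂ , cov) = u₁≢u₂ ∘ sym , λ v v≢u₂ v≢u₁ → sym (cov v v≢u₁ v≢u₂)

covertices-in : ∀ {n} (T : Tournament n) {u₁ u₂} → Covertices T u₁ u₂ →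
  ∀ v → v ≢ u₁ → v ≢ u₂ → arc T v u₁ ≡ arc T v u₂
covertices-in T (_ , cov) v v≢u₁ v≢u₂ =
  trans (anti T v _ v≢u₁) (trans (cong not (cov v v≢u₁ v≢u₂)) (sym (anti T v _ v≢u₂)))

detAlong-covertexPair : ∀ {n q} (T : Tournament n) {u₁ u₂} → Covertices T u₁ u₂ → arc T u₁ u₂ ≡ true →
  (f : Fin (suc (suc q)) → Fin n) → Injective _≡_ _≡_ f → f zero ≡ u₁ → f (suc zero) ≡ u₂ →
  detAlong T f ≡ detAlong T (λ c → f (suc (suc c)))
detAlong-covertexPair {q = q} T cov@(u₁≢u₂ , sameOut) u₁→u₂ f f-inj refl refl =
  det-covertexBlock q (skewOf (λ x y → arc T (f x) (f y)))
    refl (cong sgn u₁→u₂) (cong sgn (anti-true T u₁≢u₂ u₁→u₂)) refl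
    (λ c → cong sgn (sameOut (f (suc (suc c))) (fresh₀ c) (fresh₁ c)))
    (λ r → cong sgn (covertices-in T cov (f (suc (suc r))) (fresh₀ r) (fresh₁ r)))
  where
  fresh₀ : ∀ c → f (suc (suc c)) ≢ f zero
  fresh₀ c e with () ← f-inj e
  fresh₁ : ∀ c → f (suc (suc c)) ≢ f (suc zero)
  fresh₁ c e with () ← f-inj e

-- The classes 𝒟_k and covertices

InD-cong : ∀ {n m} (R S : Tournament n) → (∀ u v → arc R u v ≡ arc S u v) → InD m R → InD m S
InD-cong R S R≗S R∈D p f f-inj =
  subst (ℤ._≤ _) (detAlong-cong R S f f λ x y _ → R≗S (f x) (f y)) (R∈D p f f-inj)

InD-induced : ∀ {n k m} (R : Tournament n) (g : Fin k → Fin n) (g-inj : Injective _≡_ _≡_ g) →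
  InD m R → InD m (induced R g g-inj)
InD-induced R g g-inj R∈D p f f-inj = R∈D p (g ∘ f) (f-inj ∘ g-inj)

delete : ∀ {n} → Tournament (suc n) → Fin (suc n) → Tournament n
delete R a = induced R (punchIn a) (punchIn-injective a _ _)

redirect : ∀ {n} → Fin n → Fin n → Fin n → Fin n
redirect a b v with v ≟ a
... | yes _ = b
... | no  _ = v

module _ {n} {a b : Fin n} where

  redirect-≢ : a ≢ b → ∀ {u} → u ≢ b → redirect a b u ≢ a
  redirect-≢ a≢b {u} u≢b with u ≟ a
  ... | yes _   = a≢b ∘ sym
  ... | no  u≢a = u≢a

  redirect-injective : ∀ {u w} → u ≢ b → w ≢ b → redirect a b u ≡ redirect a b w → u ≡ w
  redirect-injective {u} {w} u≢b w≢b e with u ≟ a | w ≟ a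
  ... | yes u≡a | yes w≡a = trans u≡a (sym w≡a)
  ... | yes _   | no  _   = ⊥-elim (w≢b (sym e))
  ... | no  _   | yes _   = ⊥-elim (u≢b e)
  ... | no  _   | no  _   = e

  redirect-arc : ∀ (R : Tournament n) → Covertices R a b → ∀ {u w} → u ≢ w → u ≢ b → w ≢ b →
    arc R (redirect a b u) (redirect a b w) ≡ arc R u w
  redirect-arc R cov@(_ , sameOut) {u} {w} u≢w u≢b w≢b with u ≟ a | w ≟ a
  ... | yes u≡a | yes w≡a = ⊥-elim (u≢w (trans u≡a (sym w≡a)))
  ... | yes refl | no w≢a = sym (sameOut w w≢a w≢b)
  ... | no  u≢a | yes refl = sym (covertices-in R cov u u≢a u≢b)
  ... | no  _   | no  _   = refl

module _ {n m} (R : Tournament (suc n)) {a b : Fin (suc n)} (cov : Covertices R a b)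
         (a→b : arc R a b ≡ true) (R-a∈D : InD m (delete R a)) where

  private
    Bounded : ∀ {p} → (Fin p → Fin (suc n)) → Set
    Bounded f = detAlong R f ℤ.≤ + (oddNat m ℕ.* oddNat m)

    bounded-avoiding-a : ∀ {p} (f : Fin p → Fin (suc n)) → Injective _≡_ _≡_ f →
      (∀ x → f x ≢ a) → Bounded f
    bounded-avoiding-a {p} f f-inj f≢a =
      subst (ℤ._≤ _) (detAlong-cong R R (punchIn a ∘ g) f λ x y _ → cong₂ (arc R) (back x) (back y))
        (R-a∈D p g g-inj)
      where
      g : Fin p → Fin n
      g x = punchOut (f≢a x ∘ sym)
      back : ∀ x → punchIn a (g x) ≡ f x
      back x = punchIn-punchOut (f≢a x ∘ sym)
      g-inj : Injective _≡_ _≡_ g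
      g-inj {x} {y} gx≡gy = f-inj (trans (sym (back x)) (trans (cong (punchIn a) gx≡gy) (back y)))

    bounded-avoiding-b : ∀ {p} (f : Fin p → Fin (suc n)) → Injective _≡_ _≡_ f →
      (∀ x → f x ≢ b) → Bounded f
    bounded-avoiding-b f f-inj f≢b =
      subst (ℤ._≤ _)
        (detAlong-cong R R (redirect a b ∘ f) f λ x y x≢y →
           redirect-arc R cov (x≢y ∘ f-inj) (f≢b x) (f≢b y))
        (bounded-avoiding-a (redirect a b ∘ f) (f-inj ∘ redirect-injective (f≢b _) (f≢b _))
           λ x → redirect-≢ (proj₁ cov) (f≢b x))

    bounded-containing : ∀ {p} (f : Fin p → Fin (suc n)) → Injective _≡_ _≡_ f →
      ∀ {s t} → f s ≡ a → f t ≡ b → Bounded f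
    bounded-containing {suc zero} f f-inj {zero} {zero} fs≡a ft≡b =
      ⊥-elim (proj₁ cov (trans (sym fs≡a) ft≡b))
    bounded-containing {suc (suc q)} f f-inj {s} {t} fs≡a ft≡b =
      subst (ℤ._≤ _)
        (sym (begin
          detAlong R f                        ≡⟨ sym (detAlong-moveToFront R f t) ⟩
          detAlong R (f ∘ moveToFront t)      ≡⟨ sym (detAlong-moveToFront R (f ∘ moveToFront t) (suc s′)) ⟩
          detAlong R g                        ≡⟨ detAlong-covertexPair R cov a→b g g-inj g0≡a ft≡b ⟩
          detAlong R (λ c → g (suc (suc c))) ∎))
        (bounded-avoiding-a (λ c → g (suc (suc c))) (suc-injective ∘ suc-injective ∘ g-inj) fresh)
      where
      open ≡-Reasoning
      t≢s : t ≢ s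
      t≢s t≡s = proj₁ cov (trans (sym fs≡a) (trans (cong f (sym t≡s)) ft≡b))
      s′ : Fin (suc q)
      s′ = punchOut t≢s
      g : Fin (suc (suc q)) → Fin (suc n)
      g = f ∘ moveToFront t ∘ moveToFront (suc s′)
      g-inj : Injective _≡_ _≡_ g
      g-inj = moveToFront-injective (suc s′) ∘ moveToFront-injective t ∘ f-inj
      g0≡a : g zero ≡ a
      g0≡a = trans (cong f (punchIn-punchOut t≢s)) fs≡a
      fresh : ∀ c → g (suc (suc c)) ≢ a
      fresh c e with () ← g-inj {suc (suc c)} {zero} (trans e (sym g0≡a))

  InD-covertices : InD m R
  InD-covertices p f f-inj with any? (λ x → f x ≟ b)
  ... | no  ¬b = bounded-avoiding-b f f-inj λ x fx≡b → ¬b (x , fx≡b)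
  ... | yes (t , ft≡b) with any? (λ x → f x ≟ a)
  ...   | no  ¬a = bounded-avoiding-a f f-inj λ x fx≡a → ¬a (x , fx≡a)
  ...   | yes (s , fs≡a) = bounded-containing f f-inj fs≡a ft≡b

-- Diamonds

Unique-complete : ∀ {n} {xs : Vec (Fin n) n} → Unique xs → ∀ w → w ∈ xs
Unique-complete {n} {xs} xs-unique w with DecMembership._∈?_ _≟_ w xs
... | yes w∈xs = w∈xs
... | no  w∉xs =
  ⊥-elim (ℕP.n≮n n (injective⇒≤ λ {i} {j} → lookup-injective (w-fresh ∷ xs-unique) i j))
  where
  w-fresh : All (w ≢_) xs
  w-fresh = lookup⁻ λ i w≡xsᵢ → w∉xs (subst (_∈ xs) (sym w≡xsᵢ) (∈-lookup i xs))

separated⇒¬covertices : ∀ {n} (T : Tournament n) {p q r} → r ≢ p → r ≢ q →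
  arc T q r ≡ true → arc T r p ≡ true → ¬ Covertices T p q
separated⇒¬covertices T {p} {q} {r} r≢p r≢q q→r r→p (_ , sameOut) with
  trans (sym (anti-true T r≢p r→p)) (trans (sameOut r r≢p r≢q) q→r)
... | ()

apex⇒¬covertices : ∀ {n} (T : Tournament n) {v p r s} →
  (∀ w → w ≢ v → arc T v w ≡ true) ⊎ (∀ w → w ≢ v → arc T w v ≡ true) →
  r ≢ v → s ≢ v → r ≢ p → s ≢ p → arc T r p ≡ true → arc T p s ≡ true → ¬ Covertices T v p
apex⇒¬covertices T (inj₁ v→all) r≢v s≢v r≢p s≢p r→p p→s cov =
  separated⇒¬covertices T r≢p r≢v (v→all _ r≢v) r→p (covertices-sym T cov)
apex⇒¬covertices T (inj₂ all→v) r≢v s≢v r≢p s≢p r→p p→s =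
  separated⇒¬covertices T s≢v s≢p p→s (all→v _ s≢v)

-- The apex and the 3-cycle exhaust Fin 4, and any two of them are separated by a third vertex.
diamond⇒¬covertices : ∀ {n} {T : Tournament n} → IsDiamond T → ∀ {x y} → ¬ Covertices T x y
diamond⇒¬covertices {T = T}
  (refl , v , dom , a , b , c , a≢v , b≢v , c≢v , a≢b , b≢c , a≢c , a→b , b→c , c→a) {x} {y} cov =
  noPair (Unique-complete unique x) (Unique-complete unique y) cov
  where
  unique : Unique (v ∷ a ∷ b ∷ c ∷ [])
  unique = (a≢v ∘ sym ∷ b≢v ∘ sym ∷ c≢v ∘ sym ∷ []) ∷ (a≢b ∷ a≢c ∷ []) ∷ (b≢c ∷ []) ∷ [] ∷ []
  ab : ¬ Covertices T a b
  ab = separated⇒¬covertices T (a≢c ∘ sym) (b≢c ∘ sym) b→c c→a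
  bc : ¬ Covertices T b c
  bc = separated⇒¬covertices T a≢b a≢c c→a a→b
  ca : ¬ Covertices T c a
  ca = separated⇒¬covertices T b≢c (a≢b ∘ sym) a→b b→c
  va : ¬ Covertices T v a
  va = apex⇒¬covertices T dom c≢v b≢v (a≢c ∘ sym) (a≢b ∘ sym) c→a a→b
  vb : ¬ Covertices T v b
  vb = apex⇒¬covertices T dom a≢v c≢v a≢b (b≢c ∘ sym) a→b b→c
  vc : ¬ Covertices T v c
  vc = apex⇒¬covertices T dom b≢v a≢v b≢c a≢c b→c c→a
  noPair : ∀ {x y} → x ∈ (v ∷ a ∷ b ∷ c ∷ []) → y ∈ (v ∷ a ∷ b ∷ c ∷ []) → ¬ Covertices T x y
  noPair (here refl) (here refl) (x≢y , _) = x≢y refl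
  noPair (here refl) (there (here refl)) = va
  noPair (here refl) (there (there (here refl))) = vb
  noPair (here refl) (there (there (there (here refl)))) = vc
  noPair (there (here refl)) (here refl) cov = va (covertices-sym T cov)
  noPair (there (here refl)) (there (here refl)) (x≢y , _) = x≢y refl
  noPair (there (here refl)) (there (there (here refl))) = ab
  noPair (there (here refl)) (there (there (there (here refl)))) cov = ca (covertices-sym T cov)
  noPair (there (there (here refl))) (here refl) cov = vb (covertices-sym T cov)
  noPair (there (there (here refl))) (there (here refl)) cov = ab (covertices-sym T cov)
  noPair (there (there (here refl))) (there (there (here refl))) (x≢y , _) = x≢y refl
  noPair (there (there (here refl))) (there (there (there (here refl)))) = bc
  noPair (there (there (there (here refl)))) (here refl) cov = vc (covertices-sym T cov)
  noPair (there (there (there (here refl)))) (there (here refl)) = ca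
  noPair (there (there (there (here refl)))) (there (there (here refl))) cov = bc (covertices-sym T cov)
  noPair (there (there (there (here refl)))) (there (there (there (here refl)))) (x≢y , _) = x≢y refl

-- CR tournaments and blowups

AssociatedBy : (Bool → Bool) → ∀ {n} → Tournament n → Fin n → Fin n → Set
AssociatedBy f T u₁ u₂ = u₁ ≢ u₂ × (∀ v → v ≢ u₁ → v ≢ u₂ → arc T u₁ v ≡ f (arc T u₂ v))

CRShape : ∀ {n} → ℕ → Tournament n → Set
CRShape {n} m R =
  n ≡ 1 ⊎ n ≡ 2 ⊎ IsDiamond R ⊎ (∀ (σ : Fin n → Bool) → NonCRVertex R σ → ¬ InD m (extend R σ))

extend-covertices : ∀ {n} (R : Tournament n) (σ : Fin n → Bool) {x y} → Covertices R x y → σ x ≡ σ y →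
  Covertices (extend R σ) (suc x) (suc y)
extend-covertices R σ (x≢y , sameOut) σx≡σy =
  x≢y ∘ suc-injective ,
  λ { zero    _     _     → cong not σx≡σy
    ; (suc w) w≢sx w≢sy → sameOut w (w≢sx ∘ cong suc) (w≢sy ∘ cong suc) }

module _ {n} (R : Tournament (suc (suc n))) (i : Fin (suc n))
         (cov : Covertices R zero (suc i)) (0→i : arc R zero (suc i) ≡ true) where

  private
    R₀ : Tournament (suc n)
    R₀ = delete R zero

    lift : (Fin (suc n) → Bool) → Fin (suc (suc n)) → Bool
    lift σ = σ i Vector.∷ σ

    twin : Fin (suc (suc n)) → Fin (suc n)
    twin zero    = i
    twin (suc j) = j

  InDprev-delete : ∀ m → InDprev m R₀ → InDprev m R
  InDprev-delete zero    ()
  InDprev-delete (suc m) = InD-covertices {m = m} R cov 0→i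

  InD-extend-lift : ∀ {m} σ → InD m (extend R₀ σ) → InD m (extend R (lift σ))
  InD-extend-lift {m} σ =
    InD-covertices {m = m} (extend R (lift σ)) (extend-covertices R (lift σ) cov refl) 0→i ∘
    InD-cong {m = m} (extend R₀ σ) (delete (extend R (lift σ)) (suc zero)) arcs≡
    where
    arcs≡ : ∀ u v → arc (extend R₀ σ) u v ≡ arc (delete (extend R (lift σ)) (suc zero)) u v
    arcs≡ zero    zero    = refl
    arcs≡ zero    (suc v) = refl
    arcs≡ (suc u) zero    = refl
    arcs≡ (suc u) (suc v) = refl

  associated-lift : ∀ f σ j → AssociatedBy f (extend R (lift σ)) zero (suc j) →
    AssociatedBy f (extend R₀ σ) zero (suc (twin j))
  associated-lift f σ zero (_ , sameOut) = (λ ()) , λ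
    { zero    0≢0 _     → ⊥-elim (0≢0 refl)
    ; (suc k) _   k≢i →
        trans (sameOut (suc (suc k)) (λ ()) (λ ())) (cong f (proj₂ cov (suc k) (λ ()) k≢i)) }
  associated-lift f σ (suc j) (_ , sameOut) = (λ ()) , λ
    { zero    0≢0 _     → ⊥-elim (0≢0 refl)
    ; (suc k) _   k≢j → sameOut (suc (suc k)) (λ ()) (k≢j ∘ suc-injective) }

  CRVertex-lift : ∀ σ → CRVertex R (lift σ) → CRVertex R₀ σ
  CRVertex-lift σ (j , assoc) = twin j , Sum.map (associated-lift id σ j) (associated-lift not σ j) assoc

  CRShape-delete : ∀ {m} → CRShape m R → CRShape m R₀
  CRShape-delete (inj₁ ())
  CRShape-delete (inj₂ (inj₁ refl)) = inj₁ refl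
  CRShape-delete (inj₂ (inj₂ (inj₁ R-diamond))) = ⊥-elim (diamond⇒¬covertices {T = R} R-diamond cov)
  CRShape-delete {m} (inj₂ (inj₂ (inj₂ noExtension))) = inj₂ (inj₂ (inj₂ λ σ nonCR R₀σ∈D →
    noExtension (lift σ) (nonCR ∘ CRVertex-lift σ) (InD-extend-lift {m} σ R₀σ∈D)))

  CR-delete : CR R → CR R₀
  CR-delete (m , R∈D , R∉Dprev , shape) =
    m , InD-induced {m = m} R (punchIn zero) (punchIn-injective zero _ _) R∈D ,
    R∉Dprev ∘ InDprev-delete m , CRShape-delete {m} shape

blowup-covertices : ∀ {n} (T : Tournament n) i → Covertices (blowup T i) zero (suc i)
blowup-covertices T i = (λ ()) , λ
  { zero    0≢0 _   → ⊥-elim (0≢0 refl)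
  ; (suc j) _   j≢i → cong (if_then true else arc T i j) (dec-false (j ≟ i) (j≢i ∘ cong suc)) }

blowup-transitive : ∀ {n} (T : Tournament n) i → arc (blowup T i) zero (suc i) ≡ true
blowup-transitive T i = cong (if_then true else arc T i i) (dec-true (i ≟ i) refl)

proposition4p8 : ∀ (n : ℕ) (T : Tournament (suc n)) →
    StrongCR T ⇔ (∀ i → CR (blowup T i))
proposition4p8 n T = mk⇔ proj₂ λ blowupsCR →
  -- CR (delete (blowup T zero) zero) unfolds to CR T: the two have the same arcs, and CR sees only arcs.
  CR-delete (blowup T zero) zero (blowup-covertices T zero) (blowup-transitive T zero) (blowupsCR zero) , blowupsCR
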